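{- For every positive integer $k$ there exists a finite one popular color graph $G_k$ with chromatic number $\chi(G_k)\geq k$.
   Context: A graph $G$ is a one popular color graph if its edges admit a coloring such that (1) each vertex is incident with at most two edges of any given color, and (2') every cycle of $G$ contains at least one color on at least two of its edges. -}

module Defs where

open import Data.Nat as ℕ using (ℕ; zero; suc; _≤_; _<?_)
open import Data.Fin using (Fin; zero; suc; toℕ; fromℕ<)
open import Data.Empty using (⊥)
open import Data.Bool using (Bool; true; false; T)
open import Data.Product using (Σ; _×_; ∃-syntax)
open import Relation.Binary.PropositionalEquality using (_≡_; _≢_)
open import Relation.Nullary using (¬_; yes; no)
open import Function.Definitions using (Injective)

record Graph (n : ℕ) : Set where
  field
    adj     : Fin n → Fin n → Bool
    adj-sym : ∀ u v → adj u v ≡ adj v u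
    irrefl  : ∀ v → adj v v ≡ false

open Graph public

Adj : ∀ {n} → Graph n → Fin n → Fin n → Set
Adj G u v = T (adj G u v)

-- An edge colouring with colours in ℕ: a colour c u v for each pair,
-- only meaningful on edges, required to be symmetric on edges
-- (so it is a function of the unordered edge {u,v}).
record EdgeColouring {n : ℕ} (G : Graph n) : Set where
  field
    col     : Fin n → Fin n → ℕ
    col-sym : ∀ u v → Adj G u v → col u v ≡ col v u

open EdgeColouring public

next : ∀ {m} → Fin (suc m) → Fin (suc m)
next {m} i with toℕ i <? m
... | yes p = suc (fromℕ< p)
... | no _  = zero

record Cycle {n : ℕ} (G : Graph n) : Set where
  field
    l        : ℕ
    vtx      : Fin (suc (suc (suc l))) → Fin n
    distinct : Injective _≡_ _≡_ vtx
    edges    : ∀ i → Adj G (vtx i) (vtx (next i))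

open Cycle public

AtMostTwoPerColour : ∀ {n} (G : Graph n) → EdgeColouring G → Set
AtMostTwoPerColour {n} G c =
  ∀ (v : Fin n) (a : ℕ) (w₁ w₂ w₃ : Fin n) →
    Adj G v w₁ → Adj G v w₂ → Adj G v w₃ →
    col c v w₁ ≡ a → col c v w₂ ≡ a → col c v w₃ ≡ a →
    w₁ ≢ w₂ → w₁ ≢ w₃ → w₂ ≢ w₃ → ⊥

CycleRepeatsColour : ∀ {n} (G : Graph n) → EdgeColouring G → Set
CycleRepeatsColour G c =
  ∀ (C : Cycle G) →
    ∃[ i ] ∃[ j ] (i ≢ j × col c (vtx C i) (vtx C (next i)) ≡ col c (vtx C j) (vtx C (next j)))

OnePopularColour : ∀ {n} → Graph n → Set
OnePopularColour G = ∃[ c ] (AtMostTwoPerColour G c × CycleRepeatsColour G c)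

ProperColouring : ∀ {n} → Graph n → (m : ℕ) → (Fin n → Fin m) → Set
ProperColouring {n} G m f = ∀ (u v : Fin n) → Adj G u v → f u ≢ f v

ChromaticAtLeast : ∀ {n} → Graph n → ℕ → Set
ChromaticAtLeast {n} G k = ∀ (m : ℕ) (f : Fin n → Fin m) → ProperColouring G m f → k ≤ m

{-# OPTIONS --safe #-}
-- Tutte's construction. Given G on n vertices with χ(G) ≥ k and a one popular colouring, take an
-- independent set X of kn + 1 vertices and, for every injective map τ : V(G) → X, a copy of G whose
-- vertex y is joined to τ(y). Edges between X and the copy of τ get a colour private to τ, edges
-- inside a copy keep (a shift of) their colour in G. Each vertex then meets every new colour at most
-- once, and a cycle either stays inside one copy, where G's colouring repeats a colour, or leaves
-- some copy and re-enters it, through two edges of that copy's colour. Given a proper colouring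
-- with m ≤ k colours, by pigeonhole n vertices of X share a colour; the copy attached to them
-- avoids it, so G would be (m − 1)-colourable. Starting from the empty graph, each step raises
-- the bound on the chromatic number by one.
module Submission where

open import Defs
open import Data.Nat using (ℕ; zero; suc; _+_; _*_; _^_; _≤_; _<_; z≤n; s≤s; _≤?_; _<?_)
open import Data.Nat.Properties
  using (+-suc; +-cancelˡ-<; +-cancelˡ-≡; +-monoˡ-≤; *-monoˡ-≤; m≤m+n; ≤-trans; ≤-<-trans; <-≤-trans;
         <⇒≤; <⇒≢; <-irrefl; ≰⇒>; n<1+n; module ≤-Reasoning)
open import Data.Fin using (Fin; zero; suc; toℕ; fromℕ; fromℕ<; inject₁; inject≤; punchOut; finToFun; funToFin)
open import Data.Fin.Properties
  using (_≟_; ¬Fin0; toℕ-injective; toℕ<n; toℕ-fromℕ; toℕ-fromℕ<; toℕ-inject₁; ≤fromℕ; inject≤-injective;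
         punchOut-injective; finToFun-funToFin; all?; any?; ¬∀⟶∃¬; +↔⊎; *↔×)
open import Data.Fin.Induction using (<-weakInduction; <-weakInduction-startingFrom)
open import Data.List using (List; []; _∷_; length; filter; lookup; allFin)
open import Data.List.Properties using (length-tabulate)
open import Data.List.Membership.Propositional using (_∈_)
open import Data.List.Membership.Propositional.Properties using (∈-lookup; ∈-allFin)
open import Data.List.Relation.Unary.Any using (here; there)
open import Data.List.Relation.Unary.All as All using (All; _∷_)
import Data.List.Relation.Unary.All.Properties as All
open import Data.List.Relation.Unary.Unique.Propositional using (Unique; _∷_)
open import Data.List.Relation.Unary.Unique.Propositional.Properties as Unique using (allFin⁺)
open import Data.List.Relation.Binary.Sublist.Propositional using (_⊆_)
open import Data.List.Relation.Binary.Sublist.Propositional.Properties as Sublist using (filter-⊆; length-mono-≤)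
open import Data.Bool using (T)
open import Data.Bool.Properties using (T?)
open import Data.Sum using (_⊎_; inj₁; inj₂)
open import Data.Sum.Function.Propositional using (_⊎-↔_)
open import Data.Empty using (⊥; ⊥-elim)
open import Data.Product as Product using (Σ; ∃-syntax; _×_; _,_; proj₁; proj₂; uncurry)
open import Function using (_∘_; id; _⇔_; mk⇔; _↔_; Inverse; Injection)
open import Function.Definitions using (Injective)
open import Function.Properties.Inverse using (↔-refl; ↔-trans; ↔⇒↣)
open import Level using (Level)
open import Relation.Binary.Definitions using (DecidableEquality)
open import Relation.Binary.PropositionalEquality
  using (_≡_; _≢_; refl; sym; trans; cong; cong₂; subst; subst₂; module ≡-Reasoning)
open import Relation.Nullary using (¬_; Dec; yes; no; ¬?; contradiction)
open import Relation.Nullary.Decidable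
  using (⌊_⌋; toWitness; fromWitness; isYes≗does; does-⇔; dec-false; decidable-stable; map′; _×-dec_; _→-dec_)
open import Relation.Unary using (Pred; Decidable)
open import Relation.Unary.Properties using (∁?)

private
  variable
    ℓ : Level
    A B : Set

length-filter-∁ : {P : Pred A ℓ} (P? : Decidable P) (xs : List A) →
                  length (filter P? xs) + length (filter (∁? P?) xs) ≡ length xs
length-filter-∁ P? []       = refl
length-filter-∁ P? (x ∷ xs) with P? x
... | yes _ = cong suc (length-filter-∁ P? xs)
... | no  _ = trans (+-suc _ _) (cong suc (length-filter-∁ P? xs))

lookup-injective : {xs : List A} → Unique xs → Injective _≡_ _≡_ (lookup xs)
lookup-injective (_    ∷ _) {zero}  {zero}  _ = refl
lookup-injective (x∉xs ∷ _) {zero}  {suc j} e = contradiction e (All.lookup x∉xs (∈-lookup j))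
lookup-injective (x∉xs ∷ _) {suc i} {zero}  e = contradiction (sym e) (All.lookup x∉xs (∈-lookup i))
lookup-injective (_ ∷ !xs)  {suc i} {suc j} e = cong suc (lookup-injective !xs e)

module _ (_≟ᴮ_ : DecidableEquality B) (f : A → B) where

  fibre : B → List A → List A
  fibre b = filter (λ x → f x ≟ᴮ b)

  fibre-pigeonhole : ∀ s (bs : List B) (xs : List A) → All (λ x → f x ∈ bs) xs →
                     length bs * s < length xs → ∃[ b ] s ≤ length (fibre b xs)
  fibre-pigeonhole s []       []      _       ()
  fibre-pigeonhole s []       (_ ∷ _) (() ∷ _) _
  fibre-pigeonhole s (b ∷ bs) xs      f∈      big with s ≤? length (fibre b xs)
  ... | yes s≤fibre = b , s≤fibre
  ... | no  s≰fibre = Product.map₂ (λ s≤ → ≤-trans s≤ (length-mono-≤ fibre-of-rest⊆fibre))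
                                   (fibre-pigeonhole s bs rest rest-coloured rest-big)
    where
    rest : List A
    rest = filter (∁? (λ x → f x ≟ᴮ b)) xs

    fibre-of-rest⊆fibre : ∀ {b′} → fibre b′ rest ⊆ fibre b′ xs
    fibre-of-rest⊆fibre = Sublist.filter⁺ _ _ (λ { refl → id }) (filter-⊆ _ xs)

    rest-coloured : All (λ x → f x ∈ bs) rest
    rest-coloured = All.zipWith (λ { (here fx≡b , fx≢b) → contradiction fx≡b fx≢b
                                   ; (there fx∈bs , _) → fx∈bs })
                                (All.filter⁺ _ f∈ , All.all-filter _ xs)

    rest-big : length bs * s < length rest
    rest-big = +-cancelˡ-< s _ _ (begin-strict
      s + length bs * s                    <⟨ big ⟩
      length xs                            ≡⟨ length-filter-∁ _ xs ⟨
      length (fibre b xs) + length rest    ≤⟨ +-monoˡ-≤ _ (<⇒≤ (≰⇒> s≰fibre)) ⟩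
      s + length rest                      ∎)
      where open ≤-Reasoning

monochromatic-injection : ∀ {N m} s (f : Fin N → Fin m) → m * s < N →
  ∃[ c ] Σ (Fin s → Fin N) λ σ → Injective _≡_ _≡_ σ × (∀ i → f (σ i) ≡ c)
monochromatic-injection {N} {m} s f ms<N = c , σ , σ-injective , σ-colour
  where
  lengths : length (allFin m) * s < length (allFin N)
  lengths = subst₂ (λ a b → a * s < b)
                   (sym (length-tabulate {n = m} id)) (sym (length-tabulate {n = N} id)) ms<N

  big-fibre : ∃[ c ] s ≤ length (fibre _≟_ f c (allFin N))
  big-fibre = fibre-pigeonhole _≟_ f s (allFin m) (allFin N) (All.universal (∈-allFin ∘ f) _) lengths

  c : Fin m
  c = proj₁ big-fibre

  σ : Fin s → Fin N
  σ i = lookup (fibre _≟_ f c (allFin N)) (inject≤ i (proj₂ big-fibre))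

  σ-injective : Injective _≡_ _≡_ σ
  σ-injective = inject≤-injective _ _ _ _ ∘ lookup-injective (Unique.filter⁺ _ (allFin⁺ N))

  σ-colour : ∀ i → f (σ i) ≡ c
  σ-colour i = All.lookup (All.all-filter (λ x → f x ≟ c) (allFin N)) (∈-lookup _)

next-inject₁ : ∀ {m} (i : Fin m) → next (inject₁ i) ≡ suc i
next-inject₁ {m} i with toℕ (inject₁ i) <? m
... | yes i<m = cong suc (toℕ-injective (trans (toℕ-fromℕ< i<m) (toℕ-inject₁ i)))
... | no  i≮m = contradiction (subst (_< m) (sym (toℕ-inject₁ i)) (toℕ<n i)) i≮m

next-fromℕ : ∀ m → next (fromℕ m) ≡ zero
next-fromℕ m with toℕ (fromℕ m) <? m
... | yes m<m = contradiction (subst (_< m) (toℕ-fromℕ m) m<m) (<-irrefl refl)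
... | no  _   = refl

next-invariant : ∀ {m} (Q : Pred (Fin (suc m)) ℓ) → (∀ i → Q i → Q (next i)) →
                 ∀ {i} → Q i → ∀ j → Q j
next-invariant Q step {i} Qᵢ = <-weakInduction Q Q₀ step-suc
  where
  step-suc : ∀ j → Q (inject₁ j) → Q (suc j)
  step-suc j = subst Q (next-inject₁ j) ∘ step (inject₁ j)

  Q₀ : Q zero
  Q₀ = subst Q (next-fromℕ _) (step _ (<-weakInduction-startingFrom Q Qᵢ step-suc (≤fromℕ i)))

module _ {m} {Q : Pred (Fin (suc m)) ℓ} (Q? : Decidable Q) where

  enters : ∀ {i j} → ¬ Q i → Q j → ∃[ a ] (¬ Q a × Q (next a))
  enters ¬Qᵢ Qⱼ with any? (λ a → ¬? (Q? a) ×-dec Q? (next a))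
  ... | yes entry = entry
  ... | no ¬entry = contradiction Qⱼ (next-invariant (¬_ ∘ Q) stays-out ¬Qᵢ _)
    where
    stays-out : ∀ a → ¬ Q a → ¬ Q (next a)
    stays-out a ¬Qₐ Qₐ₊₁ = ¬entry (a , ¬Qₐ , Qₐ₊₁)

  leaves : ∀ {i j} → Q i → ¬ Q j → ∃[ b ] (Q b × ¬ Q (next b))
  leaves Qᵢ ¬Qⱼ with any? (λ b → Q? b ×-dec ¬? (Q? (next b)))
  ... | yes exit = exit
  ... | no ¬exit = contradiction (next-invariant Q stays-in Qᵢ _) ¬Qⱼ
    where
    stays-in : ∀ b → Q b → Q (next b)
    stays-in b Q_b = decidable-stable (Q? (next b)) (λ ¬Qₙ → ¬exit (b , Q_b , ¬Qₙ))

isYes-⇔ : ∀ {C D : Set} → C ⇔ D → (c? : Dec C) (d? : Dec D) → ⌊ c? ⌋ ≡ ⌊ d? ⌋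
isYes-⇔ C⇔D c? d? = trans (isYes≗does c?) (trans (does-⇔ C⇔D c? d?) (sym (isYes≗does d?)))

injective? : ∀ {a b} (f : Fin a → Fin b) → Dec (Injective _≡_ _≡_ f)
injective? f = map′ (λ inj {i} {j} → inj i j) (λ inj i j → inj)
                    (all? λ i → all? λ j → (f i ≟ f j) →-dec (i ≟ j))

-- Copies of G are indexed by all maps Fin n → Fin N (P = N ^ n); only those along an injective
-- map are joined to the independent base Fin N, the others stay isolated.
module Tutte {n} (G : Graph n) (c : EdgeColouring G) (N : ℕ) where

  P : ℕ
  P = N ^ n

  Vertex : Set
  Vertex = Fin N ⊎ (Fin P × Fin n)

  pattern base x   = inj₁ x
  pattern copy p y = inj₂ (p , y)

  attachment : Fin P → Fin n → Fin N
  attachment = finToFun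

  Attached : Fin P → Fin n → Fin N → Set
  Attached p y x = Injective _≡_ _≡_ (attachment p) × attachment p y ≡ x

  attached? : ∀ p y x → Dec (Attached p y x)
  attached? p y x = injective? (attachment p) ×-dec (attachment p y ≟ x)

  infix 4 _~_ _~?_

  data _~_ : Vertex → Vertex → Set where
    inner : ∀ {p y z} → Adj G y z → copy p y ~ copy p z
    up    : ∀ {p y x} → Attached p y x → copy p y ~ base x
    down  : ∀ {p y x} → Attached p y x → base x ~ copy p y

  _~?_ : ∀ u v → Dec (u ~ v)
  base _   ~? base _   = no λ ()
  base x   ~? copy p y = map′ down (λ { (down a) → a }) (attached? p y x)
  copy p y ~? base x   = map′ up (λ { (up a) → a }) (attached? p y x)
  copy p y ~? copy q z with p ≟ q
  ... | yes refl = map′ inner (λ { (inner a) → a }) (T? (adj G y z))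
  ... | no  p≢q  = no λ { (inner _) → p≢q refl }

  ~-sym : ∀ {u v} → u ~ v → v ~ u
  ~-sym {copy _ y} {copy _ z} (inner a) = inner (subst T (adj-sym G y z) a)
  ~-sym (up a)   = down a
  ~-sym (down a) = up a

  ~-irrefl : ∀ {v} → ¬ v ~ v
  ~-irrefl {copy _ y} (inner a) = subst T (irrefl G y) a

  inner⁻¹ : ∀ {p q y z} → copy p y ~ copy q z → Adj G y z
  inner⁻¹ (inner a) = a

  -- The shift by P keeps colours inside copies apart from the colours toℕ p < P of crossing edges.
  colour : Vertex → Vertex → ℕ
  colour (base _)   (base _)   = 0
  colour (base _)   (copy p _) = toℕ p
  colour (copy p _) (base _)   = toℕ p
  colour (copy _ y) (copy _ z) = P + col c y z

  colour-sym : ∀ {u v} → u ~ v → colour u v ≡ colour v u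
  colour-sym {copy _ y} {copy _ z} (inner a) = cong (P +_) (col-sym c y z a)
  colour-sym (up _)   = refl
  colour-sym (down _) = refl

  cross≢inner : ∀ (p : Fin P) a → toℕ p ≢ P + a
  cross≢inner p a = <⇒≢ (<-≤-trans (toℕ<n p) (m≤m+n P a))

  base-colour-injective : ∀ {p q y z x} → Attached p y x → Attached q z x → toℕ p ≡ toℕ q →
                          (p , y) ≡ (q , z)
  base-colour-injective (inj , σy≡x) (_ , σz≡x) p≡q with refl ← toℕ-injective p≡q =
    cong (_ ,_) (inj (trans σy≡x (sym σz≡x)))

  at-most-two : AtMostTwoPerColour G c →
                ∀ {v w₁ w₂ w₃ a} → v ~ w₁ → v ~ w₂ → v ~ w₃ →
                colour v w₁ ≡ a → colour v w₂ ≡ a → colour v w₃ ≡ a →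
                w₁ ≢ w₂ → w₁ ≢ w₃ → w₂ ≢ w₃ → ⊥
  at-most-two _ (down a₁) (down a₂) _ e₁ e₂ _ d₁₂ _ _ =
    d₁₂ (cong inj₂ (base-colour-injective a₁ a₂ (trans e₁ (sym e₂))))
  at-most-two _ (up (_ , refl)) (up (_ , refl)) _ _ _ _ d₁₂ _ _ = d₁₂ refl
  at-most-two _ (up _)    (inner _) _        e₁ e₂ _  _ _ _ = cross≢inner _ _ (trans e₁ (sym e₂))
  at-most-two _ (inner _) (up _)    _        e₁ e₂ _  _ _ _ = cross≢inner _ _ (trans e₂ (sym e₁))
  at-most-two _ (inner _) (inner _) (up _)   e₁ _  e₃ _ _ _ = cross≢inner _ _ (trans e₃ (sym e₁))
  at-most-two two {copy p y} (inner a₁) (inner a₂) (inner a₃) refl e₂ e₃ d₁₂ d₁₃ d₂₃ =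
    two y _ _ _ _ a₁ a₂ a₃ refl (+-cancelˡ-≡ P _ _ e₂) (+-cancelˡ-≡ P _ _ e₃)
        (d₁₂ ∘ cong (copy p)) (d₁₃ ∘ cong (copy p)) (d₂₃ ∘ cong (copy p))

  InCopy : Fin P → Vertex → Set
  InCopy p v = ∃[ y ] v ≡ copy p y

  inCopy? : ∀ p v → Dec (InCopy p v)
  inCopy? p (base _)   = no λ { (_ , ()) }
  inCopy? p (copy q y) with q ≟ p
  ... | yes refl = yes (y , refl)
  ... | no  q≢p  = no λ { (_ , refl) → q≢p refl }

  edge-meets-copy : ∀ {u v} → u ~ v → ∃[ p ] (InCopy p u ⊎ InCopy p v)
  edge-meets-copy (inner {p} _) = p , inj₁ (_ , refl)
  edge-meets-copy (up {p} _)    = p , inj₁ (_ , refl)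
  edge-meets-copy (down {p} _)  = p , inj₂ (_ , refl)

  entering-colour : ∀ {p u v} → u ~ v → ¬ InCopy p u → InCopy p v → colour u v ≡ toℕ p
  entering-colour (down _)  _    (_ , refl) = refl
  entering-colour (inner _) ¬inᵤ (_ , refl) = contradiction (_ , refl) ¬inᵤ

  leaving-colour : ∀ {p u v} → u ~ v → InCopy p u → ¬ InCopy p v → colour u v ≡ toℕ p
  leaving-colour (up _)    (_ , refl) _    = refl
  leaving-colour (inner _) (_ , refl) ¬inᵥ = contradiction (_ , refl) ¬inᵥ

  module _ {l} (w : Fin (suc (suc (suc l))) → Vertex) (w-injective : Injective _≡_ _≡_ w)
           (step : ∀ i → w i ~ w (next i)) where

    RepeatedColour : Set
    RepeatedColour = ∃[ i ] ∃[ j ] (i ≢ j × colour (w i) (w (next i)) ≡ colour (w j) (w (next j)))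

    within-copy : CycleRepeatsColour G c → ∀ {p} → (∀ i → InCopy p (w i)) → RepeatedColour
    within-copy cyc {p} inside =
      let (i , j , i≢j , same) = cyc cycle in
      i , j , i≢j , (begin
        colour (w i) (w (next i))      ≡⟨ colour-inside i ⟩
        P + col c (y i) (y (next i))   ≡⟨ cong (P +_) same ⟩
        P + col c (y j) (y (next j))   ≡⟨ colour-inside j ⟨
        colour (w j) (w (next j))      ∎)
      where
      open ≡-Reasoning

      y : Fin (suc (suc (suc l))) → Fin n
      y = proj₁ ∘ inside

      w≡copy : ∀ i → w i ≡ copy p (y i)
      w≡copy = proj₂ ∘ inside

      cycle : Cycle G
      cycle = record
        { l        = l
        ; vtx      = y
        ; distinct = λ {i} {j} e → w-injective (trans (w≡copy i) (trans (cong (copy p) e) (sym (w≡copy j))))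
        ; edges    = λ i → inner⁻¹ (subst₂ _~_ (w≡copy i) (w≡copy (next i)) (step i))
        }

      colour-inside : ∀ i → colour (w i) (w (next i)) ≡ P + col c (y i) (y (next i))
      colour-inside i = cong₂ colour (w≡copy i) (w≡copy (next i))

    -- A cycle leaving copy p must re-enter it, and both crossing edges have colour p.
    across-copy : ∀ {p i j} → InCopy p (w i) → ¬ InCopy p (w j) → RepeatedColour
    across-copy {p} inᵢ ¬inⱼ with enters (inCopy? p ∘ w) ¬inⱼ inᵢ | leaves (inCopy? p ∘ w) inᵢ ¬inⱼ
    ... | a , ¬inₐ , inₐ₊₁ | b , in-b , ¬in-b₊₁ =
      a , b , (λ { refl → ¬inₐ in-b }) ,
      trans (entering-colour (step a) ¬inₐ inₐ₊₁) (sym (leaving-colour (step b) in-b ¬in-b₊₁))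

    vertex-in-a-copy : ∃[ p ] ∃[ i ] InCopy p (w i)
    vertex-in-a-copy with edge-meets-copy (step zero)
    ... | p , inj₁ in₀ = p , zero , in₀
    ... | p , inj₂ in₁ = p , next zero , in₁

    repeated-colour : CycleRepeatsColour G c → RepeatedColour
    repeated-colour cyc with vertex-in-a-copy
    ... | p , _ , inᵢ with all? (inCopy? p ∘ w)
    ...   | yes inside = within-copy cyc inside
    ...   | no ¬inside = across-copy inᵢ (proj₂ (¬∀⟶∃¬ _ _ (inCopy? p ∘ w) ¬inside))

  n′ : ℕ
  n′ = N + P * n

  vertices : Fin n′ ↔ Vertex
  vertices = ↔-trans +↔⊎ (↔-refl ⊎-↔ *↔×)

  open Inverse vertices using (to; from; strictlyInverseˡ)

  to-injective : Injective _≡_ _≡_ to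
  to-injective = Injection.injective (↔⇒↣ vertices)

  G′ : Graph n′
  G′ = record
    { adj     = λ a b → ⌊ to a ~? to b ⌋
    ; adj-sym = λ a b → isYes-⇔ (mk⇔ ~-sym ~-sym) (to a ~? to b) (to b ~? to a)
    ; irrefl  = λ a → trans (isYes≗does (to a ~? to a)) (dec-false (to a ~? to a) ~-irrefl)
    }

  C′ : EdgeColouring G′
  C′ = record
    { col     = λ a b → colour (to a) (to b)
    ; col-sym = λ a b a~b → colour-sym (toWitness {a? = to a ~? to b} a~b)
    }

  adj-to : ∀ {a b} → Adj G′ a b → to a ~ to b
  adj-to {a} {b} = toWitness {a? = to a ~? to b}

  adj-from : ∀ {u v} → u ~ v → Adj G′ (from u) (from v)
  adj-from {u} {v} u~v =
    fromWitness {a? = to (from u) ~? to (from v)}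
                (subst₂ _~_ (sym (strictlyInverseˡ u)) (sym (strictlyInverseˡ v)) u~v)

  at-most-two′ : AtMostTwoPerColour G c → AtMostTwoPerColour G′ C′
  at-most-two′ two v a w₁ w₂ w₃ a₁ a₂ a₃ e₁ e₂ e₃ d₁₂ d₁₃ d₂₃ =
    at-most-two two (adj-to a₁) (adj-to a₂) (adj-to a₃) e₁ e₂ e₃
                (d₁₂ ∘ to-injective) (d₁₃ ∘ to-injective) (d₂₃ ∘ to-injective)

  cycle-repeats-colour′ : CycleRepeatsColour G c → CycleRepeatsColour G′ C′
  cycle-repeats-colour′ cyc C =
    repeated-colour (to ∘ vtx C) (distinct C ∘ to-injective) (adj-to ∘ edges C) cyc

  -- An m-colouring of G′ with m * n < N is constant on the attachment points of some copy,
  -- which therefore avoids that colour.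
  colouring-of-a-copy : ∀ {m} (f : Fin n′ → Fin (suc m)) → ProperColouring G′ (suc m) f →
                        suc m * n < N → ∃[ h ] ProperColouring G m h
  colouring-of-a-copy {m} f proper small with monochromatic-injection n (f ∘ from ∘ base) small
  ... | c₀ , τ , τ-injective , τ-colour = h , h-proper
    where
    p : Fin P
    p = funToFin τ

    p-along-τ : ∀ y → attachment p y ≡ τ y
    p-along-τ = finToFun-funToFin τ

    attached : ∀ y → Attached p y (τ y)
    attached y = (λ {i} {j} e → τ-injective (trans (sym (p-along-τ i)) (trans e (p-along-τ j))))
               , p-along-τ y

    avoids : ∀ y → c₀ ≢ f (from (copy p y))
    avoids y c₀≡ = proper _ _ (adj-from (down (attached y))) (trans (τ-colour y) c₀≡)

    h : Fin n → Fin m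
    h y = punchOut (avoids y)

    h-proper : ProperColouring G m h
    h-proper y z a = proper _ _ (adj-from (inner a)) ∘ punchOut-injective (avoids y) (avoids z)

  chromatic′ : ∀ {k} → ChromaticAtLeast G k → k * n < N → ChromaticAtLeast G′ (suc k)
  chromatic′ _ kn<N zero    f _ = ⊥-elim (¬Fin0 (f (from (base (fromℕ< kn<N)))))
  chromatic′ {k} χ kn<N (suc m) f proper with suc m ≤? k
  ... | yes m<k = s≤s (uncurry (χ m) (colouring-of-a-copy f proper (≤-<-trans (*-monoˡ-≤ n m<k) kn<N)))
  ... | no  m≮k = ≰⇒> m≮k

OnePopularGraphOfChromaticAtLeast : ℕ → Set
OnePopularGraphOfChromaticAtLeast k = ∃[ n ] ∃[ G ] (OnePopularColour {n} G × ChromaticAtLeast G k)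

empty-graph : OnePopularGraphOfChromaticAtLeast 0
empty-graph = 0 , G₀ , (c₀ , (λ ()) , (λ C → ⊥-elim (¬Fin0 (vtx C zero)))) , (λ _ _ _ → z≤n)
  where
  G₀ : Graph 0
  G₀ = record { adj = λ () ; adj-sym = λ () ; irrefl = λ () }

  c₀ : EdgeColouring G₀
  c₀ = record { col = λ () ; col-sym = λ () }

one-popular-graph : ∀ k → OnePopularGraphOfChromaticAtLeast k
one-popular-graph zero    = empty-graph
one-popular-graph (suc k) with one-popular-graph k
... | n , G , (c , two , cyc) , χ =
  n′ , G′ , (C′ , at-most-two′ two , cycle-repeats-colour′ cyc) , chromatic′ χ (n<1+n (k * n))
  where open Tutte G c (suc (k * n))

theorem3p3 : ∀ (k : ℕ) → 1 ≤ k →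
    ∃[ n ] ∃[ G ] (OnePopularColour {n} G × ChromaticAtLeast G k)
theorem3p3 k _ = one-popular-graph k
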